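{- Let $n\ge 2$ and let $\mathcal{F}$ be a maximal coclique of $\Gamma_{2n}$. Any two $\mathcal{F}$-red $(n-1)$-spaces intersect. Any two $\mathcal{F}$-red $n$-spaces are not in general position, i.e. they meet in at least a line.
   Context: $\mathrm{PG}(2n,q)$ is the projective space of projective dimension $2n$ over $\mathbb{F}_q$; an $i$-space is a subspace of projective dimension $i$. An $(n-1,n)$-flag is a pair $(A,B)$ with $A$ an $(n-1)$-space, $B$ an $n$-space and $A\subseteq B$. Two flags $(A_1,B_1),(A_2,B_2)$ are opposite if $A_1\cap B_2=A_2\cap B_1=\emptyset$. $\Gamma_{2n}$ is the graph on $(n-1,n)$-flags with adjacency being oppositeness; a maximal coclique is a set of pairwise non-opposite flags not properly contained in another such set. An $(n-1)$-space or $n$-space is called $\mathcal{F}$-red if it occurs in exactly $\frac{q^{n+1}-1}{q-1}$ flags of $\mathcal{F}$. Two $n$-spaces of $\mathrm{PG}(2n,q)$ are in general position if they meet in only a point. -}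

module Defs where

open import Level using (0ℓ)
open import Data.Nat using (ℕ; zero; suc; _^_) renaming (_+_ to _+ℕ_)
open import Data.Fin using (Fin)
open import Data.Vec using (Vec; []; _∷_; zipWith; map; replicate; lookup)
open import Data.Product using (Σ; _×_; _,_; ∃; ∃-syntax)
open import Relation.Binary.PropositionalEquality using (_≡_; _≢_)
open import Relation.Nullary using (¬_)
open import Function.Bundles using (_↔_)
open import Algebra.Structures using (IsCommutativeRing)

record FiniteField : Set₁ where
  field
    Carrier : Set
    _+_ _*_ : Carrier → Carrier → Carrier
    -_      : Carrier → Carrier
    0# 1#   : Carrier
    isCommutativeRing : IsCommutativeRing _≡_ _+_ _*_ -_ 0# 1#
    0≢1     : 0# ≢ 1#
    inverse : ∀ x → x ≢ 0# → ∃[ y ] (x * y ≡ 1#)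
    q       : ℕ
    enum    : Fin q ↔ Carrier

-- number of points of PG(n,q):  1 + q + ... + q^n  =  (q^{n+1}-1)/(q-1)
θ : ℕ → ℕ → ℕ
θ zero    q = 1
θ (suc n) q = θ n q +ℕ q ^ suc n

-- The projective space PG(m-1, q), modelled as the vector space K^m.
-- A projective subspace of projective dimension i is a vector subspace
-- of K^m of (vector) dimension i+1, given as a predicate on vectors
-- that admits a basis of i+1 vectors.

module PG (K : FiniteField) (m : ℕ) where
  open FiniteField K

  V : Set
  V = Vec Carrier m

  0v : V
  0v = replicate m 0#

  _⊕_ : V → V → V
  _⊕_ = zipWith _+_

  _·_ : Carrier → V → V
  c · v = map (c *_) v

  lincomb : ∀ {k} → Vec Carrier k → Vec V k → V
  lincomb []       []       = 0v
  lincomb (c ∷ cs) (v ∷ vs) = (c · v) ⊕ lincomb cs vs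

  LinIndep : ∀ {k} → Vec V k → Set
  LinIndep {k} vs = ∀ (cs : Vec Carrier k) → lincomb cs vs ≡ 0v → ∀ j → lookup cs j ≡ 0#

  Spans : ∀ {k} → Vec V k → (V → Set) → Set
  Spans {k} vs S = ∀ v → (S v → ∃[ cs ] (v ≡ lincomb cs vs)) × (∃[ cs ] (v ≡ lincomb cs vs) → S v)

  record Sub (k : ℕ) : Set₁ where
    constructor sub
    field
      pts   : V → Set
      basis : Vec V k
      indep : LinIndep basis
      spans : Spans basis pts
  open Sub public

  Space : ℕ → Set₁
  Space i = Sub (suc i)

  _⊆_ : ∀ {k l} → Sub k → Sub l → Set
  S ⊆ T = ∀ v → pts S v → pts T v

  SameSpace : ∀ {k} → Sub k → Sub k → Set
  SameSpace S T = (S ⊆ T) × (T ⊆ S)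

  Disjoint : ∀ {k l} → Sub k → Sub l → Set
  Disjoint S T = ∀ v → pts S v → pts T v → v ≡ 0v

  Meet : ∀ {k l} → Sub k → Sub l → Set
  Meet S T = ∃[ v ] (v ≢ 0v × pts S v × pts T v)

  MeetInLine : ∀ {k l} → Sub k → Sub l → Set
  MeetInLine S T = ∃[ u ] ∃[ w ] (LinIndep (u ∷ w ∷ [])
                     × pts S u × pts T u × pts S w × pts T w)

  -- (n-1,n)-flags: A an (n-1)-space (vector dim n), B an n-space (vector dim n+1)
  record Flag (n : ℕ) : Set₁ where
    constructor flag
    field
      A   : Sub n
      B   : Sub (suc n)
      A⊆B : A ⊆ B
  open Flag public

  Opposite : ∀ {n} → Flag n → Flag n → Set
  Opposite f g = Disjoint (A f) (B g) × Disjoint (A g) (B f)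

  _≈F_ : ∀ {n} → Flag n → Flag n → Set
  f ≈F g = SameSpace (A f) (A g) × SameSpace (B f) (B g)

  FlagSet : ℕ → Set₁
  FlagSet n = Flag n → Set

  Coclique : ∀ {n} → FlagSet n → Set₁
  Coclique F = ∀ f g → F f → F g → ¬ Opposite f g

  MaximalCoclique : ∀ {n} → FlagSet n → Set₁
  MaximalCoclique {n} F =
    Coclique F × (∀ (G : FlagSet n) → Coclique G → (∀ f → F f → G f) → ∀ f → G f → F f)

  -- the collection of flags satisfying P has exactly N elements
  -- (counted up to equality _≈F_ of flags)
  HasSize : ∀ {n} → (Flag n → Set) → ℕ → Set₁
  HasSize {n} P N = Σ (Fin N → Flag n) λ e →
      (∀ i → P (e i))
    × (∀ i j → e i ≈F e j → i ≡ j)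
    × (∀ f → P f → ∃[ i ] (f ≈F e i))

  RedLow : ∀ {n} → FlagSet n → Sub n → Set₁
  RedLow {n} F S = HasSize (λ f → F f × SameSpace (A f) S) (θ n q)

  RedHigh : ∀ {n} → FlagSet n → Sub (suc n) → Set₁
  RedHigh {n} F S = HasSize (λ f → F f × SameSpace (B f) S) (θ n q)

{-# OPTIONS --safe #-}
-- If two red (n-1)-spaces S and T were disjoint, some flag (S, B) of F would have B ∩ T = ∅:
-- otherwise each such B is spanned by S and a point of T, so the θ n q flags through S would give
-- θ n q distinct nonzero coordinate vectors in K^n, which has only q^n - 1 < θ n q of them. By
-- symmetry some flag (T, B') of F has B' ∩ S = ∅, and these two flags are opposite, contradicting
-- that F is a coclique. Dually, if two red n-spaces S and T met in at most a point p, every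
-- hyperplane A of S with (A, S) in F that meets T would contain p; the normal vectors of these
-- hyperplanes, with the coordinate at which p is nonzero dropped, are again θ n q distinct nonzero
-- vectors of K^n.
module Submission where

open import Level using (0ℓ)
open import Algebra.Bundles using (CommutativeRing)
open import Data.Empty using (⊥-elim)
open import Data.Fin as Fin using (Fin; zero; suc; punchIn; combine)
import Data.Fin.Properties as Fin
open import Data.Nat as ℕ using (ℕ; zero; suc; _<_; _≤_; s≤s; z≤n; _^_)
import Data.Nat.Properties as ℕ
open import Data.Product using (_×_; _,_; ∃; proj₁; proj₂)
open import Data.Sum using (_⊎_; inj₁; inj₂)
open import Data.Vec as Vec using (Vec; []; _∷_; lookup; tabulate; replicate)
import Data.Vec.Properties as Vec
open import Data.Vec.Functional using (insertAt; removeAt)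
open import Data.Vec.Functional.Properties using (insertAt-lookup; insertAt-punchIn)
open import Function using (_∘_; flip; Inverse; Injective)
open import Relation.Binary.Definitions using (DecidableEquality)
open import Relation.Binary.PropositionalEquality
open import Relation.Nullary using (¬_; Dec; yes; no)
open import Relation.Nullary.Decidable using (map′; ¬?; _×-dec_; decidable-stable)
open import Relation.Unary using (Decidable)
open import Defs

lookup-extensionality : ∀ {A : Set} {n} {u v : Vec A n} → (∀ i → lookup u i ≡ lookup v i) → u ≡ v
lookup-extensionality {u = u} {v} u≗v =
  trans (sym (Vec.tabulate∘lookup u)) (trans (Vec.tabulate-cong u≗v) (Vec.tabulate∘lookup v))

tabulate-injective : ∀ {A : Set} {n} {f g : Fin n → A} → tabulate f ≡ tabulate g → ∀ i → f i ≡ g i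
tabulate-injective {f = f} {g} f≡g i =
  trans (sym (Vec.lookup∘tabulate f i)) (trans (cong (λ v → lookup v i) f≡g) (Vec.lookup∘tabulate g i))

module FiniteFieldProperties (K : FiniteField) where

  open FiniteField K public using (Carrier; 0≢1; inverse; q)

  commutativeRing : CommutativeRing 0ℓ 0ℓ
  commutativeRing = record { isCommutativeRing = FiniteField.isCommutativeRing K }

  open CommutativeRing commutativeRing public
    using (_+_; _*_; -_; 0#; 1#; +-comm; +-identityˡ; +-identityʳ; -‿inverseˡ; -‿inverseʳ;
           *-comm; *-assoc; *-identityˡ; *-identityʳ; zeroˡ; zeroʳ; distribˡ)
  open CommutativeRing commutativeRing using (semiring; ring; +-group)
  open import Algebra.Properties.Semiring.Sum semiring public
    using (sum; sum-cong-≗; sum-remove; ∑-comm; ∑-distrib-+; *-distribˡ-sum; *-distribʳ-sum)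
  open import Algebra.Properties.Semiring.Sum semiring using (sum-replicate-zero)
  open import Algebra.Properties.Ring ring using (-‿distribˡ-*; -‿distribʳ-*)
  open import Algebra.Properties.Group +-group using (inverseˡ-unique; ⁻¹-involutive)
  open Inverse (FiniteField.enum K) using (to; from; strictlyInverseˡ)

  _≟_ : DecidableEquality Carrier
  x ≟ y = map′ from-injective (cong from) (from x Fin.≟ from y)
    where
    from-injective : from x ≡ from y → x ≡ y
    from-injective e = trans (sym (strictlyInverseˡ x)) (trans (cong to e) (strictlyInverseˡ y))

  ∃-scalar? : {P : Carrier → Set} → Decidable P → Dec (∃ P)
  ∃-scalar? {P} P? = map′ (λ (i , p) → to i , p) (λ (x , p) → from x , subst P (sym (strictlyInverseˡ x)) p)
                          (Fin.any? (P? ∘ to))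

  ∃-vector? : ∀ k {P : Vec Carrier k → Set} → Decidable P → Dec (∃ P)
  ∃-vector? zero    P? = map′ ([] ,_) (λ { ([] , p) → p }) (P? [])
  ∃-vector? (suc k) P? = map′ (λ (c , cs , p) → c ∷ cs , p) (λ { (c ∷ cs , p) → c , cs , p })
                              (∃-scalar? λ c → ∃-vector? k (P? ∘ (c ∷_)))

  1≢0 : 1# ≢ 0#
  1≢0 = 0≢1 ∘ sym

  x+y≡0⇒x≡-y : ∀ {x y} → x + y ≡ 0# → x ≡ - y
  x+y≡0⇒x≡-y = inverseˡ-unique _ _

  x-y≡0⇒x≡y : ∀ {x y} → x + - y ≡ 0# → x ≡ y
  x-y≡0⇒x≡y {y = y} h = trans (x+y≡0⇒x≡-y h) (⁻¹-involutive y)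

  *-cancelʳ-≢0 : ∀ {a} x y → a ≢ 0# → x * a ≡ y * a → x ≡ y
  *-cancelʳ-≢0 {a} x y a≢0 xa≡ya = trans (sym (undo x)) (trans (cong (_* a⁻¹) xa≡ya) (undo y))
    where
    a⁻¹ = proj₁ (inverse a a≢0)
    undo : ∀ z → (z * a) * a⁻¹ ≡ z
    undo z = trans (*-assoc z a a⁻¹) (trans (cong (z *_) (proj₂ (inverse a a≢0))) (*-identityʳ z))

  solve-linear : ∀ {a e z s} → a * e ≡ 1# → a * z + s ≡ 0# → z ≡ (- e) * s
  solve-linear {a} {e} {z} {s} ae≡1 az+s≡0 = begin
    z              ≡⟨ sym (*-identityˡ z) ⟩
    1# * z         ≡⟨ cong (_* z) (sym (trans (*-comm e a) ae≡1)) ⟩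
    (e * a) * z    ≡⟨ *-assoc e a z ⟩
    e * (a * z)    ≡⟨ cong (e *_) (x+y≡0⇒x≡-y az+s≡0) ⟩
    e * (- s)      ≡⟨ sym (-‿distribʳ-* e s) ⟩
    - (e * s)      ≡⟨ -‿distribˡ-* e s ⟩
    (- e) * s      ∎
    where open ≡-Reasoning

  infix 7 _∙_
  _∙_ : ∀ {k} → (Fin k → Carrier) → (Fin k → Carrier) → Carrier
  u ∙ v = sum λ i → u i * v i

  sum-zero : ∀ {k} {f : Fin k → Carrier} → (∀ i → f i ≡ 0#) → sum f ≡ 0#
  sum-zero {k} f≗0 = trans (sum-cong-≗ f≗0) (sum-replicate-zero k)

  ∙-zeroʳ : ∀ {k} (u : Fin k → Carrier) {v : Fin k → Carrier} → (∀ i → v i ≡ 0#) → u ∙ v ≡ 0#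
  ∙-zeroʳ u v≗0 = sum-zero λ i → trans (cong (u i *_) (v≗0 i)) (zeroʳ (u i))

  ∙-zeroˡ : ∀ {k} {u : Fin k → Carrier} (v : Fin k → Carrier) → (∀ i → u i ≡ 0#) → u ∙ v ≡ 0#
  ∙-zeroˡ v u≗0 = sum-zero λ i → trans (cong (_* v i) (u≗0 i)) (zeroˡ (v i))

  ∙-comm : ∀ {k} (u v : Fin k → Carrier) → u ∙ v ≡ v ∙ u
  ∙-comm u v = sum-cong-≗ λ i → *-comm (u i) (v i)

  sum-neg : ∀ {k} (f : Fin k → Carrier) → sum (λ i → - f i) ≡ - sum f
  sum-neg f =
    x+y≡0⇒x≡-y (trans (sym (∑-distrib-+ (λ i → - f i) f)) (sum-zero λ i → -‿inverseˡ (f i)))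

  *-∙ : ∀ {k} t (u v : Fin k → Carrier) → t * (u ∙ v) ≡ (λ i → t * u i) ∙ v
  *-∙ t u v = trans (*-distribˡ-sum t (λ i → u i * v i)) (sum-cong-≗ λ i → sym (*-assoc t (u i) (v i)))

  ∙-sub : ∀ {k} (u a b : Fin k → Carrier) → u ∙ (λ i → a i + - b i) ≡ u ∙ a + - (u ∙ b)
  ∙-sub u a b = begin
    u ∙ (λ i → a i + - b i)
      ≡⟨ sum-cong-≗ (λ i → trans (distribˡ (u i) (a i) (- b i))
                                 (cong (u i * a i +_) (sym (-‿distribʳ-* (u i) (b i))))) ⟩
    sum (λ i → u i * a i + - (u i * b i))
      ≡⟨ ∑-distrib-+ (λ i → u i * a i) (λ i → - (u i * b i)) ⟩
    u ∙ a + sum (λ i → - (u i * b i))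
      ≡⟨ cong (u ∙ a +_) (sum-neg (λ i → u i * b i)) ⟩
    u ∙ a + - (u ∙ b)
      ∎
    where open ≡-Reasoning

  ∙-*ʳ : ∀ {k} (u v : Fin k → Carrier) x → u ∙ (λ i → v i * x) ≡ (u ∙ v) * x
  ∙-*ʳ u v x =
    trans (sum-cong-≗ λ i → sym (*-assoc (u i) (v i) x)) (sym (*-distribʳ-sum x (λ i → u i * v i)))

  ∙-swap : ∀ {R k} (d : Fin R → Carrier) (M : Fin R → Fin k → Carrier) (u : Fin k → Carrier) →
           d ∙ (λ i → M i ∙ u) ≡ (λ l → d ∙ (λ i → M i l)) ∙ u
  ∙-swap d M u = begin
    sum (λ i → d i * sum (λ l → M i l * u l))
      ≡⟨ sum-cong-≗ (λ i → *-distribˡ-sum (d i) (λ l → M i l * u l)) ⟩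
    sum (λ i → sum (λ l → d i * (M i l * u l)))
      ≡⟨ ∑-comm (λ i l → d i * (M i l * u l)) ⟩
    sum (λ l → sum (λ i → d i * (M i l * u l)))
      ≡⟨ sum-cong-≗ (λ l → sum-cong-≗ λ i → sym (*-assoc (d i) (M i l) (u l))) ⟩
    sum (λ l → sum (λ i → (d i * M i l) * u l))
      ≡⟨ sum-cong-≗ (λ l → sym (*-distribʳ-sum (u l) (λ i → d i * M i l))) ⟩
    sum (λ l → sum (λ i → d i * M i l) * u l)
      ∎
    where open ≡-Reasoning

  unit : ∀ {k} → Fin k → Vec Carrier k
  unit {suc k} zero    = 1# ∷ replicate k 0#
  unit         (suc r) = 0# ∷ unit r

  unit-∙ : ∀ {k} (r : Fin k) (v : Fin k → Carrier) → lookup (unit r) ∙ v ≡ v r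
  unit-∙ zero    v = trans (cong₂ _+_ (*-identityˡ (v zero)) (∙-zeroˡ (v ∘ suc) (flip Vec.lookup-replicate 0#)))
                           (+-identityʳ (v zero))
  unit-∙ (suc r) v = trans (cong (_+ lookup (unit r) ∙ (v ∘ suc)) (zeroˡ (v zero)))
                           (trans (+-identityˡ _) (unit-∙ r (v ∘ suc)))

  ∙-removeAt-injective : ∀ {k} (π u u′ : Fin (suc k) → Carrier) (j : Fin (suc k)) → π j ≢ 0# →
    u ∙ π ≡ 0# → u′ ∙ π ≡ 0# → (∀ t → removeAt u j t ≡ removeAt u′ j t) → ∀ i → u i ≡ u′ i
  ∙-removeAt-injective π u u′ j πj≢0 uπ≡0 u′π≡0 rest-equal i with i Fin.≟ j
  ... | no i≢j = subst (λ t → u t ≡ u′ t) (Fin.punchIn-punchOut (i≢j ∘ sym)) (rest-equal _)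
  ... | yes refl = *-cancelʳ-≢0 (u i) (u′ i) πj≢0 (begin
      u i * π i                          ≡⟨ x+y≡0⇒x≡-y (trans (sym (sum-remove (λ t → u t * π t))) uπ≡0) ⟩
      - (removeAt u i ∙ removeAt π i)    ≡⟨ cong -_ (sum-cong-≗ λ t → cong (_* removeAt π i t) (rest-equal t)) ⟩
      - (removeAt u′ i ∙ removeAt π i)   ≡⟨ x+y≡0⇒x≡-y (trans (sym (sum-remove (λ t → u′ t * π t))) u′π≡0) ⟨
      u′ i * π i                         ∎)
    where open ≡-Reasoning

  underdetermined-system : ∀ {R k} → k < R → (M : Fin R → Fin k → Carrier) →
    ∃ λ (d : Fin R → Carrier) → (∃ λ i → d i ≢ 0#) × (∀ l → d ∙ (λ i → M i l) ≡ 0#)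
  underdetermined-system {suc R} {zero} _ M = (λ _ → 1#) , (zero , 1≢0) , λ ()
  underdetermined-system {suc R} {suc k} (s≤s k<R) M with Fin.any? (λ j → ¬? (M j zero ≟ 0#))
  ... | no no-pivot = d , d≢0 , λ { zero → ∙-zeroʳ d first-column-zero ; (suc l) → solves l }
    where
    first-column-zero : ∀ i → M i zero ≡ 0#
    first-column-zero i = decidable-stable (M i zero ≟ 0#) (no-pivot ∘ (i ,_))
    rest = underdetermined-system (ℕ.m<n⇒m<1+n k<R) (λ i l → M i (suc l))
    d = proj₁ rest
    d≢0 = proj₁ (proj₂ rest)
    solves = proj₂ (proj₂ rest)
  -- Gaussian elimination with pivot row j: E clears the first column of the other rows, and a
  -- solution d′ for E extends by the entry at j that makes the first column vanish as well.
  ... | yes (j , p≢0) = d , (punchIn j i₀ , d≢0) , λ l → trans (eliminated l) (E-solved l)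
    where
    p⁻¹ = proj₁ (inverse (M j zero) p≢0)
    c : Fin (suc k) → Carrier
    c l = p⁻¹ * M j l
    E : Fin R → Fin (suc k) → Carrier
    E i l = M (punchIn j i) l + - (M (punchIn j i) zero * c l)
    E-first-column : ∀ i → E i zero ≡ 0#
    E-first-column i = let a = M (punchIn j i) zero in
      trans (cong (λ x → a + - (a * x)) (trans (*-comm p⁻¹ (M j zero)) (proj₂ (inverse (M j zero) p≢0))))
            (trans (cong (λ x → a + - x) (*-identityʳ a)) (-‿inverseʳ a))
    rest = underdetermined-system k<R (λ i l → E i (suc l))
    d′ = proj₁ rest
    i₀ = proj₁ (proj₁ (proj₂ rest))
    s = d′ ∙ (λ i → M (punchIn j i) zero)
    d = insertAt d′ j (- (s * p⁻¹))
    d≢0 : d (punchIn j i₀) ≢ 0#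
    d≢0 = proj₂ (proj₁ (proj₂ rest)) ∘ trans (sym (insertAt-punchIn d′ j _ i₀))
    E-solved : ∀ l → d′ ∙ (λ i → E i l) ≡ 0#
    E-solved zero    = ∙-zeroʳ d′ E-first-column
    E-solved (suc l) = proj₂ (proj₂ rest) l
    eliminated : ∀ l → d ∙ (λ i → M i l) ≡ d′ ∙ (λ i → E i l)
    eliminated l = begin
      d ∙ (λ i → M i l)
        ≡⟨ sum-remove {i = j} (λ i → d i * M i l) ⟩
      d j * M j l + sum (λ i → d (punchIn j i) * M (punchIn j i) l)
        ≡⟨ cong₂ _+_ pivot-term (sum-cong-≗ λ i → cong (_* M (punchIn j i) l) (insertAt-punchIn d′ j _ i)) ⟩
      - (s * c l) + d′ ∙ (λ i → M (punchIn j i) l)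
        ≡⟨ +-comm _ _ ⟩
      d′ ∙ (λ i → M (punchIn j i) l) + - (s * c l)
        ≡⟨ cong (λ x → d′ ∙ (λ i → M (punchIn j i) l) + - x) (∙-*ʳ d′ (λ i → M (punchIn j i) zero) (c l)) ⟨
      d′ ∙ (λ i → M (punchIn j i) l) + - (d′ ∙ λ i → M (punchIn j i) zero * c l)
        ≡⟨ ∙-sub d′ _ _ ⟨
      d′ ∙ (λ i → E i l)
        ∎
      where
      open ≡-Reasoning
      pivot-term : d j * M j l ≡ - (s * c l)
      pivot-term = trans (cong (_* M j l) (insertAt-lookup d′ j _))
                         (trans (sym (-‿distribˡ-* (s * p⁻¹) (M j l))) (cong -_ (*-assoc s p⁻¹ (M j l))))

  encode : ∀ {k} → Vec Carrier k → Fin (q ^ k)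
  encode []       = zero
  encode (c ∷ cs) = combine (from c) (encode cs)

  encode-injective : ∀ {k} → Injective _≡_ _≡_ (encode {k})
  encode-injective {x = []}     {[]}     _ = refl
  encode-injective {x = c ∷ cs} {d ∷ ds} e =
    let from-c≡from-d , e′ = Fin.combine-injective (from c) (encode cs) (from d) (encode ds) e
    in cong₂ _∷_ (trans (sym (strictlyInverseˡ c)) (trans (cong to from-c≡from-d) (strictlyInverseˡ d)))
                 (encode-injective e′)

  nonzero-vectors-bound : ∀ {N k} (g : Fin N → Vec Carrier k) → Injective _≡_ _≡_ g →
                          (∀ i → g i ≢ replicate k 0#) → N < q ^ k
  nonzero-vectors-bound {N} {k} g g-injective g≢0 = Fin.injective⇒≤ (h-injective ∘ encode-injective)
    where
    h : Fin (suc N) → Vec Carrier k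
    h zero    = replicate k 0#
    h (suc i) = g i
    h-injective : Injective _≡_ _≡_ h
    h-injective {zero}  {zero}  _ = refl
    h-injective {zero}  {suc j} e = ⊥-elim (g≢0 j (sym e))
    h-injective {suc i} {zero}  e = ⊥-elim (g≢0 i e)
    h-injective {suc i} {suc j} e = cong suc (g-injective e)

  q^k≤θ : ∀ k → q ^ k ≤ θ k q
  q^k≤θ zero    = ℕ.≤-refl
  q^k≤θ (suc k) = ℕ.m≤n+m (q ^ suc k) (θ k q)

  θ-positive : ∀ k → 0 < θ k q
  θ-positive zero    = s≤s z≤n
  θ-positive (suc k) = ℕ.≤-trans (θ-positive k) (ℕ.m≤m+n (θ k q) _)

module Subspaces (K : FiniteField) (m : ℕ) where

  open FiniteFieldProperties K
  open PG K m

  _≟ᵥ_ : DecidableEquality V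
  _≟ᵥ_ = Vec.≡-dec _≟_

  ≡0v : ∀ {v} → (∀ x → lookup v x ≡ 0#) → v ≡ 0v
  ≡0v v≗0 = lookup-extensionality λ x → trans (v≗0 x) (sym (Vec.lookup-replicate x 0#))

  entries : ∀ {k} → Vec V k → Fin m → Fin k → Carrier
  entries vs x i = lookup (lookup vs i) x

  lookup-lincomb : ∀ {k} (cs : Vec Carrier k) (vs : Vec V k) x →
                   lookup (lincomb cs vs) x ≡ lookup cs ∙ entries vs x
  lookup-lincomb []       []       x = Vec.lookup-replicate x 0#
  lookup-lincomb (c ∷ cs) (v ∷ vs) x =
    trans (Vec.lookup-zipWith _+_ x (c · v) (lincomb cs vs))
          (cong₂ _+_ (Vec.lookup-map x (c *_) v) (lookup-lincomb cs vs x))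

  lookup-lincomb-tabulate : ∀ {k} (f : Fin k → Carrier) (vs : Vec V k) x →
                            lookup (lincomb (tabulate f) vs) x ≡ f ∙ entries vs x
  lookup-lincomb-tabulate f vs x = trans (lookup-lincomb (tabulate f) vs x)
                                        (sum-cong-≗ λ i → cong (_* entries vs x i) (Vec.lookup∘tabulate f i))

  lincomb-zero : ∀ {k} (cs : Vec Carrier k) (vs : Vec V k) → (∀ i → lookup cs i ≡ 0#) → lincomb cs vs ≡ 0v
  lincomb-zero cs vs cs≗0 = ≡0v λ x → trans (lookup-lincomb cs vs x) (∙-zeroˡ (entries vs x) cs≗0)

  nonzero-coefficient : ∀ {k} (cs : Vec Carrier k) (vs : Vec V k) →
                        lincomb cs vs ≢ 0v → ∃ λ j → lookup cs j ≢ 0#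
  nonzero-coefficient cs vs combination≢0 with Fin.any? (λ j → ¬? (lookup cs j ≟ 0#))
  ... | yes nonzero = nonzero
  ... | no  none    = ⊥-elim (combination≢0 (lincomb-zero cs vs λ j →
                                decidable-stable (lookup cs j ≟ 0#) (none ∘ (j ,_))))

  lincomb-unit : ∀ {k} (vs : Vec V k) r → lincomb (unit r) vs ≡ lookup vs r
  lincomb-unit vs r = lookup-extensionality λ x → trans (lookup-lincomb (unit r) vs x) (unit-∙ r (entries vs x))

  lincomb-∘ : ∀ {k j} (c : Vec Carrier k) (ys : Vec V k) (α : Fin k → Vec Carrier j) (zs : Vec V j) →
              (∀ r → lookup ys r ≡ lincomb (α r) zs) →
              lincomb c ys ≡ lincomb (tabulate λ l → lookup c ∙ λ r → lookup (α r) l) zs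
  lincomb-∘ c ys α zs ys≡αzs = lookup-extensionality λ x → begin
    lookup (lincomb c ys) x
      ≡⟨ lookup-lincomb c ys x ⟩
    lookup c ∙ entries ys x
      ≡⟨ sum-cong-≗ (λ r → cong (lookup c r *_)
                               (trans (cong (λ y → lookup y x) (ys≡αzs r)) (lookup-lincomb (α r) zs x))) ⟩
    lookup c ∙ (λ r → lookup (α r) ∙ entries zs x)
      ≡⟨ ∙-swap (lookup c) (lookup ∘ α) (entries zs x) ⟩
    (λ l → lookup c ∙ λ r → lookup (α r) l) ∙ entries zs x
      ≡⟨ lookup-lincomb-tabulate _ zs x ⟨
    lookup (lincomb (tabulate λ l → lookup c ∙ λ r → lookup (α r) l) zs) x
      ∎
    where open ≡-Reasoning

  lincomb-injective : ∀ {k} {zs : Vec V k} → LinIndep zs → ∀ a b → lincomb a zs ≡ lincomb b zs → a ≡ b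
  lincomb-injective {zs = zs} independent a b a≡b = lookup-extensionality λ i →
    x-y≡0⇒x≡y (trans (sym (Vec.lookup∘tabulate difference i))
                     (independent (tabulate difference) difference≡0 i))
    where
    difference : Fin _ → Carrier
    difference i = lookup a i + - lookup b i
    difference≡0 : lincomb (tabulate difference) zs ≡ 0v
    difference≡0 = ≡0v λ x → let e = entries zs x in begin
      lookup (lincomb (tabulate difference) zs) x   ≡⟨ lookup-lincomb-tabulate difference zs x ⟩
      difference ∙ e                                ≡⟨ ∙-comm difference e ⟩
      e ∙ difference                                ≡⟨ ∙-sub e (lookup a) (lookup b) ⟩
      e ∙ lookup a + - (e ∙ lookup b)               ≡⟨ cong (λ y → y + - (e ∙ lookup b)) (begin
          e ∙ lookup a                                  ≡⟨ ∙-comm e (lookup a) ⟩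
          lookup a ∙ e                                  ≡⟨ lookup-lincomb a zs x ⟨
          lookup (lincomb a zs) x                       ≡⟨ cong (λ y → lookup y x) a≡b ⟩
          lookup (lincomb b zs) x                       ≡⟨ lookup-lincomb b zs x ⟩
          lookup b ∙ e                                  ≡⟨ ∙-comm (lookup b) e ⟩
          e ∙ lookup b                                  ∎) ⟩
      e ∙ lookup b + - (e ∙ lookup b)               ≡⟨ -‿inverseʳ _ ⟩
      0#                                            ∎
      where open ≡-Reasoning

  InSpan : ∀ {k} → Vec V k → V → Set
  InSpan ys v = ∃ λ cs → v ≡ lincomb cs ys

  InSpan? : ∀ {k} (ys : Vec V k) v → Dec (InSpan ys v)
  InSpan? {k} ys v = ∃-vector? k λ cs → v ≟ᵥ lincomb cs ys

  module _ {k} (P : Sub k) where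

    ∈⇒InSpan : ∀ {v} → pts P v → InSpan (basis P) v
    ∈⇒InSpan = proj₁ (spans P _)

    InSpan⇒∈ : ∀ {v} → InSpan (basis P) v → pts P v
    InSpan⇒∈ = proj₂ (spans P _)

    basis-∈ : ∀ r → pts P (lookup (basis P) r)
    basis-∈ r = InSpan⇒∈ (unit r , sym (lincomb-unit (basis P) r))

    coordinates : ∀ {j} (ys : Vec V j) → (∀ r → pts P (lookup ys r)) → Fin j → Vec Carrier k
    coordinates ys ys∈P = proj₁ ∘ ∈⇒InSpan ∘ ys∈P

    combined-coordinates : ∀ {j} (ys : Vec V j) → (∀ r → pts P (lookup ys r)) → Vec Carrier j → Vec Carrier k
    combined-coordinates ys ys∈P c = tabulate λ l → lookup c ∙ λ r → lookup (coordinates ys ys∈P r) l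

    lincomb-in-basis : ∀ {j} (ys : Vec V j) (ys∈P : ∀ r → pts P (lookup ys r)) c →
                       lincomb c ys ≡ lincomb (combined-coordinates ys ys∈P c) (basis P)
    lincomb-in-basis ys ys∈P c = lincomb-∘ c ys (coordinates ys ys∈P) (basis P) (proj₂ ∘ ∈⇒InSpan ∘ ys∈P)

    lincomb-∈ : ∀ {j} (ys : Vec V j) → (∀ r → pts P (lookup ys r)) → ∀ c → pts P (lincomb c ys)
    lincomb-∈ ys ys∈P c = InSpan⇒∈ (combined-coordinates ys ys∈P c , lincomb-in-basis ys ys∈P c)

  _∈?_ : ∀ {k} v (P : Sub k) → Dec (pts P v)
  v ∈? P = map′ (InSpan⇒∈ P) (∈⇒InSpan P) (InSpan? (basis P) v)

  LinIndep-[] : LinIndep []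
  LinIndep-[] [] _ ()

  LinIndep-∷ : ∀ {k} {ys : Vec V k} {v} → LinIndep ys → ¬ InSpan ys v → LinIndep (v ∷ ys)
  LinIndep-∷ {ys = ys} {v} independent v∉ys (c ∷ cs) c∷cs≡0 = by-cases (c ≟ 0#)
    where
    at : ∀ x → c * lookup v x + lookup cs ∙ entries ys x ≡ 0#
    at x = trans (sym (lookup-lincomb (c ∷ cs) (v ∷ ys) x))
                 (trans (cong (λ y → lookup y x) c∷cs≡0) (Vec.lookup-replicate x 0#))
    by-cases : Dec (c ≡ 0#) → ∀ j → lookup (c ∷ cs) j ≡ 0#
    by-cases (yes c≡0) zero    = c≡0
    by-cases (yes c≡0) (suc j) = independent cs (≡0v λ x → begin
      lookup (lincomb cs ys) x                   ≡⟨ lookup-lincomb cs ys x ⟩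
      lookup cs ∙ entries ys x                   ≡⟨ drop-first-term x ⟨
      c * lookup v x + lookup cs ∙ entries ys x  ≡⟨ at x ⟩
      0#                                         ∎) j
      where
      open ≡-Reasoning
      drop-first-term : ∀ x → c * lookup v x + lookup cs ∙ entries ys x ≡ lookup cs ∙ entries ys x
      drop-first-term x = trans (cong (_+ lookup cs ∙ entries ys x) (trans (cong (_* lookup v x) c≡0) (zeroˡ _)))
                                (+-identityˡ _)
    by-cases (no c≢0) _ = ⊥-elim (v∉ys (tabulate (λ i → (- c⁻¹) * lookup cs i) , lookup-extensionality λ x → begin
      lookup v x                                    ≡⟨ solve-linear (proj₂ (inverse c c≢0)) (at x) ⟩
      (- c⁻¹) * (lookup cs ∙ entries ys x)          ≡⟨ *-∙ (- c⁻¹) (lookup cs) (entries ys x) ⟩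
      (λ i → (- c⁻¹) * lookup cs i) ∙ entries ys x  ≡⟨ sym (lookup-lincomb-tabulate _ ys x) ⟩
      lookup (lincomb (tabulate λ i → (- c⁻¹) * lookup cs i) ys) x ∎))
      where
      open ≡-Reasoning
      c⁻¹ = proj₁ (inverse c c≢0)

  ¬LinIndep-in-Sub : ∀ {k} (P : Sub k) {ys : Vec V (suc k)} → (∀ r → pts P (lookup ys r)) → ¬ LinIndep ys
  ¬LinIndep-in-Sub {k} P {ys} ys∈P independent =
    d≢0 (trans (sym (Vec.lookup∘tabulate d i)) (independent (tabulate d) d-combination≡0 i))
    where
    α = coordinates P ys ys∈P
    dependency = underdetermined-system (ℕ.n<1+n k) (λ r l → lookup (α r) l)
    d = proj₁ dependency
    i = proj₁ (proj₁ (proj₂ dependency))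
    d≢0 = proj₂ (proj₁ (proj₂ dependency))
    γ : Fin k → Carrier
    γ l = lookup (tabulate d) ∙ λ r → lookup (α r) l
    d-combination≡0 : lincomb (tabulate d) ys ≡ 0v
    d-combination≡0 = trans (lincomb-in-basis P ys ys∈P (tabulate d)) (lincomb-zero (tabulate γ) (basis P) λ l →
      trans (Vec.lookup∘tabulate γ l)
            (trans (sum-cong-≗ λ r → cong (_* lookup (α r) l) (Vec.lookup∘tabulate d r))
                   (proj₂ (proj₂ dependency) l)))

  LinIndep⇒InSpan : ∀ {k} (P : Sub k) {ys : Vec V k} → LinIndep ys → (∀ r → pts P (lookup ys r)) →
                    ∀ {z} → pts P z → InSpan ys z
  LinIndep⇒InSpan P {ys} independent ys∈P {z} z∈P with InSpan? ys z
  ... | yes z∈ys = z∈ys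
  ... | no  z∉ys = ⊥-elim (¬LinIndep-in-Sub P z∷ys∈P (LinIndep-∷ independent z∉ys))
    where
    z∷ys∈P : ∀ r → pts P (lookup (z ∷ ys) r)
    z∷ys∈P zero    = z∈P
    z∷ys∈P (suc r) = ys∈P r

  LinIndep⇒⊆ : ∀ {k l} (P : Sub k) (Q : Sub l) {ys : Vec V k} → LinIndep ys →
               (∀ r → pts P (lookup ys r)) → (∀ r → pts Q (lookup ys r)) → P ⊆ Q
  LinIndep⇒⊆ P Q independent ys∈P ys∈Q v v∈P =
    let cs , v≡ = LinIndep⇒InSpan P independent ys∈P v∈P in subst (pts Q) (sym v≡) (lincomb-∈ Q _ ys∈Q cs)

  SameSpace-via : ∀ {k} (X Y Z : Sub k) → SameSpace X Z → SameSpace Y Z → SameSpace X Y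
  SameSpace-via X Y Z (X⊆Z , Z⊆X) (Y⊆Z , Z⊆Y) = (λ v → Z⊆Y v ∘ X⊆Z v) , (λ v → Z⊆X v ∘ Y⊆Z v)

  Meet? : ∀ {k l} (S : Sub k) (T : Sub l) → Dec (Meet S T)
  Meet? S T = ∃-vector? m λ v → ¬? (v ≟ᵥ 0v) ×-dec v ∈? S ×-dec v ∈? T

  ¬Meet⇒Disjoint : ∀ {k l} (S : Sub k) (T : Sub l) → ¬ Meet S T → Disjoint S T
  ¬Meet⇒Disjoint S T ¬meet v v∈S v∈T = decidable-stable (v ≟ᵥ 0v) λ v≢0 → ¬meet (v , v≢0 , v∈S , v∈T)

  MeetInAtMostAPoint : ∀ {k l} → Sub k → Sub l → Set
  MeetInAtMostAPoint S T = ∀ {u w} → u ≢ 0v → pts S u → pts T u → pts S w → pts T w → InSpan (u ∷ []) w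

  meet-in-line-or-point : ∀ {k l} (S : Sub k) (T : Sub l) → MeetInLine S T ⊎ MeetInAtMostAPoint S T
  meet-in-line-or-point S T with ∃-vector? m (λ u → ∃-vector? m λ w →
    ¬? (u ≟ᵥ 0v) ×-dec u ∈? S ×-dec u ∈? T ×-dec w ∈? S ×-dec w ∈? T ×-dec ¬? (InSpan? (u ∷ []) w))
  ... | yes (u , w , u≢0 , u∈S , u∈T , w∈S , w∈T , w∉u) =
    inj₁ (w , u , LinIndep-∷ (LinIndep-∷ LinIndep-[] u∉[]) w∉u , w∈S , w∈T , u∈S , u∈T)
    where
    u∉[] : ¬ InSpan [] u
    u∉[] ([] , u≡0) = u≢0 u≡0
  ... | no none = inj₂ λ {u} {w} u≢0 u∈S u∈T w∈S w∈T →
    decidable-stable (InSpan? (u ∷ []) w) λ w∉u → none (u , w , u≢0 , u∈S , u∈T , w∈S , w∈T , w∉u)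

  extensions-meeting-bound : ∀ {k N} (S T : Sub k) → Disjoint S T → (X : Fin N → Sub (suc k)) →
    (∀ i → S ⊆ X i) → (∀ i → Meet T (X i)) → (∀ i j → SameSpace (X i) (X j) → i ≡ j) → N < q ^ k
  extensions-meeting-bound {k} S T S∩T≡0 X S⊆X meet X-injective = nonzero-vectors-bound g g-injective g≢0
    where
    t : ∀ i → V
    t i = proj₁ (meet i)
    t∈T : ∀ i → pts T (t i)
    t∈T i = proj₁ (proj₂ (proj₂ (meet i)))
    g : ∀ i → Vec Carrier k
    g i = proj₁ (∈⇒InSpan T (t∈T i))
    t≡g : ∀ i → t i ≡ lincomb (g i) (basis T)
    t≡g i = proj₂ (∈⇒InSpan T (t∈T i))
    g≢0 : ∀ i → g i ≢ replicate k 0#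
    g≢0 i gᵢ≡0 = proj₁ (proj₂ (meet i))
      (trans (t≡g i) (trans (cong (λ c → lincomb c (basis T)) gᵢ≡0)
                            (lincomb-zero (replicate k 0#) (basis T) λ j → Vec.lookup-replicate j 0#)))
    t∷S : ∀ i → Vec V (suc k)
    t∷S i = t i ∷ basis S
    t∷S-independent : ∀ i → LinIndep (t∷S i)
    t∷S-independent i = LinIndep-∷ (indep S) λ t∈S →
      proj₁ (proj₂ (meet i)) (S∩T≡0 (t i) (InSpan⇒∈ S t∈S) (t∈T i))
    t∷S-∈X : ∀ i j → t i ≡ t j → ∀ r → pts (X j) (lookup (t∷S i) r)
    t∷S-∈X i j tᵢ≡tⱼ zero    = subst (pts (X j)) (sym tᵢ≡tⱼ) (proj₂ (proj₂ (proj₂ (meet j))))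
    t∷S-∈X i j _     (suc r) = S⊆X j _ (basis-∈ S r)
    X-⊆ : ∀ i j → t i ≡ t j → X i ⊆ X j
    X-⊆ i j tᵢ≡tⱼ = LinIndep⇒⊆ (X i) (X j) (t∷S-independent i) (t∷S-∈X i i refl) (t∷S-∈X i j tᵢ≡tⱼ)
    g-injective : Injective _≡_ _≡_ g
    g-injective {i} {j} gᵢ≡gⱼ = X-injective i j (X-⊆ i j tᵢ≡tⱼ , X-⊆ j i (sym tᵢ≡tⱼ))
      where
      tᵢ≡tⱼ = trans (t≡g i) (trans (cong (λ c → lincomb c (basis T)) gᵢ≡gⱼ) (sym (t≡g j)))

  module Annihilators {n} (P : Sub (suc n)) where

    -- u is read as a linear form on the coordinates with respect to basis P; since coordinates are
    -- unique, quantifying over all of them is the same as asking for one.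
    Annihilates : (Fin (suc n) → Carrier) → V → Set
    Annihilates u v = ∀ γ → v ≡ lincomb γ (basis P) → u ∙ lookup γ ≡ 0#

    annihilates : ∀ u {v} γ → v ≡ lincomb γ (basis P) → u ∙ lookup γ ≡ 0# → Annihilates u v
    annihilates u γ v≡γ uγ≡0 γ′ v≡γ′ =
      trans (cong (λ δ → u ∙ lookup δ) (lincomb-injective (indep P) γ′ γ (trans (sym v≡γ′) v≡γ))) uγ≡0

    annihilates-cong : ∀ {u u′ v} → (∀ k → u k ≡ u′ k) → Annihilates u v → Annihilates u′ v
    annihilates-cong u≗u′ u⊥v γ v≡γ =
      trans (sum-cong-≗ λ k → cong (_* lookup γ k) (sym (u≗u′ k))) (u⊥v γ v≡γ)

    annihilates-lincomb : ∀ u {j} (ys : Vec V j) (ys∈P : ∀ r → pts P (lookup ys r)) →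
                          (∀ r → Annihilates u (lookup ys r)) → ∀ c → Annihilates u (lincomb c ys)
    annihilates-lincomb u ys ys∈P u⊥ys c = annihilates u (tabulate γ) (lincomb-in-basis P ys ys∈P c) (begin
      u ∙ lookup (tabulate γ)               ≡⟨ sum-cong-≗ (λ l → cong (u l *_) (Vec.lookup∘tabulate γ l)) ⟩
      u ∙ γ                                 ≡⟨ ∙-comm u γ ⟩
      γ ∙ u                                 ≡⟨ ∙-swap (lookup c) (lookup ∘ α) u ⟨
      lookup c ∙ (λ r → lookup (α r) ∙ u)   ≡⟨ ∙-zeroʳ (lookup c) (λ r → trans (∙-comm (lookup (α r)) u) (u⊥α r)) ⟩
      0#                                    ∎)
      where
      open ≡-Reasoning
      α = coordinates P ys ys∈P
      γ : Fin (suc n) → Carrier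
      γ l = lookup c ∙ λ r → lookup (α r) l
      u⊥α : ∀ r → u ∙ lookup (α r) ≡ 0#
      u⊥α r = u⊥ys r (α r) (proj₂ (∈⇒InSpan P (ys∈P r)))

    normal-vector : (H : Sub n) → H ⊆ P →
                    ∃ λ u → (∃ λ k → u k ≢ 0#) × (∀ v → pts H v → Annihilates u v)
    normal-vector H H⊆P = u , u≢0 , λ v v∈H → let cs , v≡ = ∈⇒InSpan H v∈H in
      subst (Annihilates u) (sym v≡) (annihilates-lincomb u (basis H) basis∈P u⊥basis cs)
      where
      basis∈P : ∀ r → pts P (lookup (basis H) r)
      basis∈P r = H⊆P _ (basis-∈ H r)
      β = coordinates P (basis H) basis∈P
      solution = underdetermined-system (ℕ.n<1+n n) (λ k r → lookup (β r) k)
      u = proj₁ solution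
      u≢0 = proj₁ (proj₂ solution)
      u⊥basis : ∀ r → Annihilates u (lookup (basis H) r)
      u⊥basis r = annihilates u (β r) (proj₂ (∈⇒InSpan P (basis∈P r))) (proj₂ (proj₂ solution) r)

    annihilates-LinIndep⇒zero : ∀ u (ys : Vec V (suc n)) → LinIndep ys → (∀ r → pts P (lookup ys r)) →
                                (∀ r → Annihilates u (lookup ys r)) → ∀ k → u k ≡ 0#
    annihilates-LinIndep⇒zero u ys independent ys∈P u⊥ys k =
      trans (sym (unit-∙ k u))
            (trans (∙-comm (lookup (unit k)) u) (u⊥basis (unit k) (sym (lincomb-unit (basis P) k))))
      where
      u⊥basis : Annihilates u (lookup (basis P) k)
      u⊥basis = let cs , b≡ = LinIndep⇒InSpan P independent ys∈P (basis-∈ P k) in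
                subst (Annihilates u) (sym b≡) (annihilates-lincomb u ys ys∈P u⊥ys cs)

    annihilated-⊆ : ∀ u → (∃ λ k → u k ≢ 0#) → (H H′ : Sub n) → H ⊆ P → H′ ⊆ P →
                    (∀ v → pts H v → Annihilates u v) → (∀ v → pts H′ v → Annihilates u v) → H ⊆ H′
    annihilated-⊆ u (k , uk≢0) H H′ H⊆P H′⊆P u⊥H u⊥H′ v v∈H with InSpan? (basis H′) v
    ... | yes v∈H′ = InSpan⇒∈ H′ v∈H′
    ... | no  v∉H′ = ⊥-elim (uk≢0 (annihilates-LinIndep⇒zero u (v ∷ basis H′) (LinIndep-∷ (indep H′) v∉H′)
                                                              v∷H′∈P u⊥v∷H′ k))
      where
      v∷H′∈P : ∀ r → pts P (lookup (v ∷ basis H′) r)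
      v∷H′∈P zero    = H⊆P v v∈H
      v∷H′∈P (suc r) = H′⊆P _ (basis-∈ H′ r)
      u⊥v∷H′ : ∀ r → Annihilates u (lookup (v ∷ basis H′) r)
      u⊥v∷H′ zero    = u⊥H v v∈H
      u⊥v∷H′ (suc r) = u⊥H′ _ (basis-∈ H′ r)

    hyperplanes-through-point-bound : ∀ {N} (H : Fin N → Sub n) → (∀ i → H i ⊆ P) →
      ∀ {p} → p ≢ 0v → pts P p → (∀ i → pts (H i) p) →
      (∀ i j → SameSpace (H i) (H j) → i ≡ j) → N < q ^ n
    hyperplanes-through-point-bound H H⊆P {p} p≢0 p∈P p∈H H-injective = nonzero-vectors-bound g g-injective g≢0
      where
      normal = λ i → normal-vector (H i) (H⊆P i)
      w : ∀ i → Fin (suc n) → Carrier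
      w i = proj₁ (normal i)
      w⊥H : ∀ i v → pts (H i) v → Annihilates (w i) v
      w⊥H i = proj₂ (proj₂ (normal i))
      π = proj₁ (∈⇒InSpan P p∈P)
      p≡π : p ≡ lincomb π (basis P)
      p≡π = proj₂ (∈⇒InSpan P p∈P)
      w⊥π : ∀ i → w i ∙ lookup π ≡ 0#
      w⊥π i = w⊥H i p (p∈H i) π p≡π
      pivot = nonzero-coefficient π (basis P) λ π≡0 → p≢0 (trans p≡π π≡0)
      j₀ = proj₁ pivot
      g : ∀ i → Vec Carrier n
      g i = tabulate (removeAt (w i) j₀)
      same-normal : ∀ i j → g i ≡ g j → ∀ k → w i k ≡ w j k
      same-normal i j gᵢ≡gⱼ = ∙-removeAt-injective (lookup π) (w i) (w j) j₀ (proj₂ pivot) (w⊥π i) (w⊥π j)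
                                                   (tabulate-injective gᵢ≡gⱼ)
      H-⊆ : ∀ i j → g i ≡ g j → H i ⊆ H j
      H-⊆ i j gᵢ≡gⱼ = annihilated-⊆ (w j) (proj₁ (proj₂ (normal j))) (H i) (H j) (H⊆P i) (H⊆P j)
                        (λ v → annihilates-cong (same-normal i j gᵢ≡gⱼ) ∘ w⊥H i v) (w⊥H j)
      g-injective : Injective _≡_ _≡_ g
      g-injective {i} {j} gᵢ≡gⱼ = H-injective i j (H-⊆ i j gᵢ≡gⱼ , H-⊆ j i (sym gᵢ≡gⱼ))
      g≢0 : ∀ i → g i ≢ replicate n 0#
      g≢0 i gᵢ≡0 = let k , wᵢk≢0 = proj₁ (proj₂ (normal i)) in
        wᵢk≢0 (∙-removeAt-injective (lookup π) (w i) (λ _ → 0#) j₀ (proj₂ pivot) (w⊥π i)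
                                    (∙-zeroˡ (lookup π) λ _ → refl) removeAt-w≗0 k)
        where
        removeAt-w≗0 : ∀ t → removeAt (w i) j₀ t ≡ 0#
        removeAt-w≗0 t = trans (sym (Vec.lookup∘tabulate (removeAt (w i) j₀) t))
                               (trans (cong (λ v → lookup v t) gᵢ≡0) (Vec.lookup-replicate t 0#))

module RedSpaces (K : FiniteField) (m : ℕ) where

  open FiniteFieldProperties K
  open PG K m
  open Subspaces K m
  open Annihilators using (hyperplanes-through-point-bound)

  red-low-partner : ∀ {n} {F : FlagSet n} (S T : Sub n) → Disjoint S T → RedLow F S →
                    ∃ λ f → F f × SameSpace (A f) S × Disjoint T (B f)
  red-low-partner {n} S T S∩T≡0 (e , e∈ , e-injective , _) with Fin.any? (λ i → ¬? (Meet? T (B (e i))))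
  ... | yes (i , ¬meet) = e i , proj₁ (e∈ i) , proj₂ (e∈ i) , ¬Meet⇒Disjoint T (B (e i)) ¬meet
  ... | no  none        =
    ⊥-elim (ℕ.<⇒≱ (extensions-meeting-bound S T S∩T≡0 (B ∘ e) S⊆B meet B-injective) (q^k≤θ n))
    where
    S⊆B : ∀ i → S ⊆ B (e i)
    S⊆B i v = A⊆B (e i) v ∘ proj₂ (proj₂ (e∈ i)) v
    meet : ∀ i → Meet T (B (e i))
    meet i = decidable-stable (Meet? T (B (e i))) (none ∘ (i ,_))
    B-injective : ∀ i j → SameSpace (B (e i)) (B (e j)) → i ≡ j
    B-injective i j Bᵢ≈Bⱼ =
      e-injective i j (SameSpace-via (A (e i)) (A (e j)) S (proj₂ (e∈ i)) (proj₂ (e∈ j)) , Bᵢ≈Bⱼ)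

  red-high-partner : ∀ {n} {F : FlagSet n} (S T : Sub (suc n)) → MeetInAtMostAPoint S T → RedHigh F S →
                     ∃ λ f → F f × SameSpace (B f) S × Disjoint (A f) T
  red-high-partner {n} S T S∩T≤point (e , e∈ , e-injective , _) with Fin.any? (λ i → ¬? (Meet? (A (e i)) T))
  ... | yes (i , ¬meet) = e i , proj₁ (e∈ i) , proj₂ (e∈ i) , ¬Meet⇒Disjoint (A (e i)) T ¬meet
  ... | no  none        =
    ⊥-elim (ℕ.<⇒≱ (hyperplanes-through-point-bound S (A ∘ e) A⊆S p₀≢0 (A⊆S i₀ p₀ (p∈A i₀)) p₀∈A A-injective)
                  (q^k≤θ n))
    where
    A⊆S : ∀ i → A (e i) ⊆ S
    A⊆S i v = proj₁ (proj₂ (e∈ i)) v ∘ A⊆B (e i) v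
    meet : ∀ i → Meet (A (e i)) T
    meet i = decidable-stable (Meet? (A (e i)) T) (none ∘ (i ,_))
    p : ∀ i → V
    p i = proj₁ (meet i)
    p∈A : ∀ i → pts (A (e i)) (p i)
    p∈A i = proj₁ (proj₂ (proj₂ (meet i)))
    i₀ = Fin.fromℕ< (θ-positive n)
    p₀ = p i₀
    p₀≢0 = proj₁ (proj₂ (meet i₀))
    p₀∈A : ∀ i → pts (A (e i)) p₀
    p₀∈A i = let cs , p₀≡ = S∩T≤point (proj₁ (proj₂ (meet i))) (A⊆S i _ (p∈A i)) (proj₂ (proj₂ (proj₂ (meet i))))
                                       (A⊆S i₀ _ (p∈A i₀)) (proj₂ (proj₂ (proj₂ (meet i₀))))
             in subst (pts (A (e i))) (sym p₀≡) (lincomb-∈ (A (e i)) (p i ∷ []) (λ { zero → p∈A i }) cs)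
    A-injective : ∀ i j → SameSpace (A (e i)) (A (e j)) → i ≡ j
    A-injective i j Aᵢ≈Aⱼ =
      e-injective i j (Aᵢ≈Aⱼ , SameSpace-via (B (e i)) (B (e j)) S (proj₂ (e∈ i)) (proj₂ (e∈ j)))

  red-low-spaces-meet : ∀ {n} {F : FlagSet n} → Coclique F → ∀ S T → RedLow F S → RedLow F T → Meet S T
  red-low-spaces-meet coclique S T S-red T-red with Meet? S T
  ... | yes meet = meet
  ... | no ¬meet =
    let S∩T≡0 = ¬Meet⇒Disjoint S T ¬meet
        f , f∈F , Af≈S , T∩Bf≡0 = red-low-partner S T S∩T≡0 S-red
        g , g∈F , Ag≈T , S∩Bg≡0 = red-low-partner T S (λ v v∈T v∈S → S∩T≡0 v v∈S v∈T) T-red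
    in ⊥-elim (coclique f g f∈F g∈F ( (λ v v∈Af → S∩Bg≡0 v (proj₁ Af≈S v v∈Af))
                                     , (λ v v∈Ag → T∩Bf≡0 v (proj₁ Ag≈T v v∈Ag))))

  red-high-spaces-meet-in-line : ∀ {n} {F : FlagSet n} → Coclique F →
                                 ∀ S T → RedHigh F S → RedHigh F T → MeetInLine S T
  red-high-spaces-meet-in-line coclique S T S-red T-red with meet-in-line-or-point S T
  ... | inj₁ line  = line
  ... | inj₂ point =
    let f , f∈F , Bf≈S , Af∩T≡0 = red-high-partner S T point S-red
        g , g∈F , Bg≈T , Ag∩S≡0 = red-high-partner T S (λ u≢0 u∈T u∈S w∈T w∈S → point u≢0 u∈S u∈T w∈S w∈T)
                                                     T-red
    in ⊥-elim (coclique f g f∈F g∈F ( (λ v v∈Af v∈Bg → Af∩T≡0 v v∈Af (proj₁ Bg≈T v v∈Bg))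
                                     , (λ v v∈Ag v∈Bf → Ag∩S≡0 v v∈Ag (proj₁ Bf≈S v v∈Bf))))

open import Data.Nat using (_*_)

lemma2 : (K : FiniteField) (n : ℕ) → 2 ≤ n →
    let open PG K (suc (2 * n)) in
    (F : FlagSet n) → MaximalCoclique F →
      (∀ (S T : Sub n) → RedLow F S → RedLow F T → Meet S T)
    × (∀ (S T : Sub (suc n)) → RedHigh F S → RedHigh F T → MeetInLine S T)
lemma2 K n _ F (coclique , _) = red-low-spaces-meet coclique , red-high-spaces-meet-in-line coclique
  where open RedSpaces K (suc (2 * n))
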